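{- Let $R$ be a commutative ring with identity such that $\Gamma_0(R)$ has at least two vertices. Then $R$ is a von Neumann regular ring if and only if $\Gamma_0(R)$ is a complete graph (equivalently, if and only if any two distinct vertices of $\Gamma_1(R)$ are adjacent).
   Context: All rings are commutative with identity. $\Gamma_0(R)$ is the simple graph whose vertices are the non-trivial ideals of $R$ (ideals other than $0$ and $R$), two distinct ideals $I,J$ being adjacent iff $IJ=I\cap J$. $\Gamma_1(R)$ is the graph whose vertices are all ideals of $R$, with $I$ and $J$ adjacent iff $IJ=I\cap J$ (a loop at $I$ iff $I^2=I$). A ring $R$ is von Neumann regular if for every $a\in R$ there is $x\in R$ with $a=axa$. -}

module Defs where

open import Level using (Level; _⊔_; suc; Lift; lift)
open import Algebra.Bundles using (CommutativeRing)
open import Data.Product using (Σ; ∃; _×_; _,_)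
open import Relation.Nullary using (¬_)

module _ {c ℓ : Level} (R : CommutativeRing c ℓ) where
  open CommutativeRing R

  record Ideal : Set (suc (c ⊔ ℓ)) where
    field
      _∈I     : Carrier → Set (c ⊔ ℓ)
      ∈-resp  : ∀ {x y} → x ≈ y → x ∈I → y ∈I
      0∈      : 0# ∈I
      +-closed : ∀ {x y} → x ∈I → y ∈I → (x + y) ∈I
      neg-closed : ∀ {x} → x ∈I → (- x) ∈I
      *-closed : ∀ r {x} → x ∈I → (r * x) ∈I

  open Ideal public

  _≐_ : Ideal → Ideal → Set (c ⊔ ℓ)
  I ≐ J = (∀ x → _∈I I x → _∈I J x) × (∀ x → _∈I J x → _∈I I x)

  zeroIdeal : Ideal
  zeroIdeal = record
    { _∈I = λ x → Lift c (x ≈ 0#)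
    ; ∈-resp = λ { x≈y (lift x≈0) → lift (trans (sym x≈y) x≈0) }
    ; 0∈ = lift refl
    ; +-closed = λ { (lift p) (lift q) → lift (trans (+-cong p q) (+-identityˡ 0#)) }
    ; neg-closed = λ { (lift p) → lift (trans (-‿cong p) (-0≈0)) }
    ; *-closed = λ { r (lift p) → lift (trans (*-congˡ p) (zeroʳ r)) }
    }
    where
      -0≈0 : - 0# ≈ 0#
      -0≈0 = trans (sym (+-identityˡ (- 0#))) (-‿inverseʳ 0#)

  unitIdeal : Ideal
  unitIdeal = record
    { _∈I = λ _ → Top
    ; ∈-resp = λ _ _ → tt′
    ; 0∈ = tt′
    ; +-closed = λ _ _ → tt′
    ; neg-closed = λ _ → tt′
    ; *-closed = λ _ _ → tt′
    }
    where
      record Top : Set (c ⊔ ℓ) where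
        constructor tt′

  NonTrivial : Ideal → Set (c ⊔ ℓ)
  NonTrivial I = ¬ (I ≐ zeroIdeal) × ¬ (I ≐ unitIdeal)

  -- product ideal IJ: all finite sums of products a * b with a ∈ I, b ∈ J
  data ProdElem (I J : Ideal) : Carrier → Set (c ⊔ ℓ) where
    gen  : ∀ {x} a b → _∈I I a → _∈I J b → x ≈ a * b → ProdElem I J x
    nil  : ∀ {x} → x ≈ 0# → ProdElem I J x
    sum  : ∀ {x} y z → ProdElem I J y → ProdElem I J z → x ≈ y + z → ProdElem I J x

  Adjacent : Ideal → Ideal → Set (c ⊔ ℓ)
  Adjacent I J =
    (∀ x → ProdElem I J x → (_∈I I x × _∈I J x)) ×
    (∀ x → (_∈I I x × _∈I J x) → ProdElem I J x)

  Γ₀HasTwoVertices : Set (suc (c ⊔ ℓ))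
  Γ₀HasTwoVertices = Σ Ideal λ I → Σ Ideal λ J → NonTrivial I × NonTrivial J × ¬ (I ≐ J)

  Γ₀Complete : Set (suc (c ⊔ ℓ))
  Γ₀Complete = ∀ I J → NonTrivial I → NonTrivial J → ¬ (I ≐ J) → Adjacent I J

  Γ₁DistinctAdjacent : Set (suc (c ⊔ ℓ))
  Γ₁DistinctAdjacent = ∀ I J → ¬ (I ≐ J) → Adjacent I J

  VonNeumannRegular : Set (c ⊔ ℓ)
  VonNeumannRegular = ∀ a → ∃ λ x → a ≈ a * x * a

module Submission where

-- Regular ⇒ every pair of ideals is adjacent: an element x of I ∩ J with x = x·y·x
-- is the product (x·y)·x of an element of I and an element of J.  Adjacency to 0 or
-- to R is automatic, so (classically) completeness of Γ₀ upgrades to adjacency of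
-- any two distinct ideals.  The converse is the substance of the theorem:
--   * R is reduced.  If b ≠ 0 and b² = 0, then adjacency forces Ann(b) = ⟨b⟩, and every ideal K ≠ ⟨b⟩ containing b must contain 1; comparing
--     ⟨b⟩ with ⟨b⟩ + K for a second vertex K then makes K zero or the whole ring.
--   * Every a is regular.  Either ⟨a²⟩ = ⟨a⟩, so a = r·a², or ⟨a²⟩ and ⟨a⟩ are
--     adjacent, so a² ∈ ⟨a²⟩⟨a⟩, i.e. a²(1 − s·a) = 0; reducedness then gives
--     a(1 − s·a) = 0, i.e. a = a·s·a.

open import Defs
open import Level using (Level; _⊔_; Lift; lift; lower)
open import Algebra.Bundles using (CommutativeRing)
open import Data.Product using (_×_; Σ; _,_)
open import Data.Sum using (_⊎_; inj₁; inj₂)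
open import Data.Empty using (⊥; ⊥-elim)
open import Function.Bundles using (_⇔_; mk⇔)
open import Axiom.ExcludedMiddle using (ExcludedMiddle)
open import Relation.Nullary using (¬_; yes; no)

module IdealTheory {c ℓ : Level} (R : CommutativeRing c ℓ) where
  open CommutativeRing R
  open import Algebra.Properties.Ring ring
    using (-‿distribˡ-*; -‿distribʳ-*; x[y-z]≈xy-xz; x∙y⁻¹≈ε⇒x≈y; x≈y⇒x∙y⁻¹≈ε;
           //-rightDividesˡ)
  open import Algebra.Properties.AbelianGroup +-abelianGroup using (⁻¹-∙-comm)
  open import Algebra.Properties.CommutativeSemigroup +-commutativeSemigroup
    renaming (interchange to +-interchange)
  open import Algebra.Properties.CommutativeSemigroup *-commutativeSemigroup
    renaming (interchange to *-interchange)
  open import Relation.Binary.Reasoning.Setoid setoid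

  _∈_ : Carrier → Ideal R → Set (c ⊔ ℓ)
  x ∈ I = _∈I I x

  ∈R : ∀ x → x ∈ unitIdeal R
  ∈R _ = 0∈ (unitIdeal R)

  1∈⇒unit : ∀ I → 1# ∈ I → _≐_ R I (unitIdeal R)
  1∈⇒unit I 1∈I = (λ x _ → ∈R x) , (λ x _ → ∈-resp I (*-identityʳ x) (*-closed I x 1∈I))

  ⟨_⟩ : Carrier → Ideal R
  ⟨ b ⟩ = record
    { _∈I = λ x → Σ Carrier λ r → x ≈ r * b
    ; ∈-resp = λ { x≈y (r , x≈rb) → r , trans (sym x≈y) x≈rb }
    ; 0∈ = 0# , sym (zeroˡ b)
    ; +-closed = λ { (r , p) (s , q) → r + s , trans (+-cong p q) (sym (distribʳ b r s)) }
    ; neg-closed = λ { (r , p) → - r , trans (-‿cong p) (-‿distribˡ-* r b) }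
    ; *-closed = λ { t (r , p) → t * r , trans (*-congˡ p) (sym (*-assoc t r b)) }
    }

  b∈⟨b⟩ : ∀ b → b ∈ ⟨ b ⟩
  b∈⟨b⟩ b = 1# , sym (*-identityˡ b)

  ⟨⟩-least : ∀ {b} K → b ∈ K → ∀ x → x ∈ ⟨ b ⟩ → x ∈ K
  ⟨⟩-least K b∈K x (r , x≈rb) = ∈-resp K (sym x≈rb) (*-closed K r b∈K)

  Ann : Carrier → Ideal R
  Ann b = record
    { _∈I = λ y → Lift c (b * y ≈ 0#)
    ; ∈-resp = λ { x≈y (lift p) → lift (trans (*-congˡ (sym x≈y)) p) }
    ; 0∈ = lift (zeroʳ b)
    ; +-closed = λ { (lift p) (lift q) →
        lift (trans (distribˡ b _ _) (trans (+-cong p q) (+-identityˡ 0#))) }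
    ; neg-closed = λ { {x} (lift p) →
        lift (trans (sym (-‿distribʳ-* b x)) (trans (-‿cong p) (-0≈0))) }
    ; *-closed = λ { r {x} (lift p) → lift (begin
        b * (r * x) ≈⟨ *-congˡ (*-comm r x) ⟩
        b * (x * r) ≈⟨ *-assoc b x r ⟨
        b * x * r   ≈⟨ *-congʳ p ⟩
        0# * r      ≈⟨ zeroˡ r ⟩
        0#          ∎) }
    }
    where
      -0≈0 : - 0# ≈ 0#
      -0≈0 = trans (sym (+-identityˡ (- 0#))) (-‿inverseʳ 0#)

  _⊕_ : Ideal R → Ideal R → Ideal R
  I ⊕ K = record
    { _∈I = λ x → Σ Carrier λ i → Σ Carrier λ k → i ∈ I × k ∈ K × x ≈ i + k
    ; ∈-resp = λ { x≈y (i , k , i∈I , k∈K , p) → i , k , i∈I , k∈K , trans (sym x≈y) p }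
    ; 0∈ = 0# , 0# , 0∈ I , 0∈ K , sym (+-identityˡ 0#)
    ; +-closed = λ { (i , k , i∈I , k∈K , p) (i′ , k′ , i′∈I , k′∈K , p′) →
        i + i′ , k + k′ , +-closed I i∈I i′∈I , +-closed K k∈K k′∈K ,
        trans (+-cong p p′) (+-interchange i k i′ k′) }
    ; neg-closed = λ { (i , k , i∈I , k∈K , p) →
        - i , - k , neg-closed I i∈I , neg-closed K k∈K , trans (-‿cong p) (sym (⁻¹-∙-comm i k)) }
    ; *-closed = λ { r (i , k , i∈I , k∈K , p) →
        r * i , r * k , *-closed I r i∈I , *-closed K r k∈K , trans (*-congˡ p) (distribˡ r i k) }
    }

  -- The inclusion IJ ⊆ I ∩ J holds for all ideals, so adjacency is the reverse inclusion.
  product⊆meet : ∀ I J x → ProdElem R I J x → x ∈ I × x ∈ J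
  product⊆meet I J x (gen a b a∈I b∈J x≈ab) =
    ∈-resp I (trans (*-comm b a) (sym x≈ab)) (*-closed I b a∈I) ,
    ∈-resp J (sym x≈ab) (*-closed J a b∈J)
  product⊆meet I J x (nil x≈0) = ∈-resp I (sym x≈0) (0∈ I) , ∈-resp J (sym x≈0) (0∈ J)
  product⊆meet I J x (sum y z y∈IJ z∈IJ x≈y+z)
    with product⊆meet I J y y∈IJ | product⊆meet I J z z∈IJ
  ... | y∈I , y∈J | z∈I , z∈J =
    ∈-resp I (sym x≈y+z) (+-closed I y∈I z∈I) , ∈-resp J (sym x≈y+z) (+-closed J y∈J z∈J)

  meet⊆product⇒adjacent : ∀ I J → (∀ x → x ∈ I → x ∈ J → ProdElem R I J x) → Adjacent R I J
  meet⊆product⇒adjacent I J meet⊆IJ = product⊆meet I J , λ x (x∈I , x∈J) → meet⊆IJ x x∈I x∈J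

  product-swap : ∀ I J x → ProdElem R I J x → ProdElem R J I x
  product-swap I J x (gen a b a∈I b∈J x≈ab) = gen b a b∈J a∈I (trans x≈ab (*-comm a b))
  product-swap I J x (nil x≈0) = nil x≈0
  product-swap I J x (sum y z y∈IJ z∈IJ x≈y+z) =
    sum y z (product-swap I J y y∈IJ) (product-swap I J z z∈IJ) x≈y+z

  adjacent-sym : ∀ I J → Adjacent R I J → Adjacent R J I
  adjacent-sym I J (_ , meet⊆IJ) = meet⊆product⇒adjacent J I λ x x∈J x∈I →
    product-swap I J x (meet⊆IJ x (x∈I , x∈J))

  zero-adjacent : ∀ I J → _≐_ R I (zeroIdeal R) → Adjacent R I J
  zero-adjacent I J (I⊆0 , _) = meet⊆product⇒adjacent I J λ x x∈I _ → nil (lower (I⊆0 x x∈I))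

  unit-adjacent : ∀ I J → _≐_ R I (unitIdeal R) → Adjacent R I J
  unit-adjacent I J (_ , R⊆I) = meet⊆product⇒adjacent I J λ x _ x∈J →
    gen 1# x (R⊆I 1# (∈R 1#)) x∈J (sym (*-identityˡ x))

  principal-product : ∀ {b} J x → ProdElem R ⟨ b ⟩ J x → Σ Carrier λ j → j ∈ J × x ≈ b * j
  principal-product {b} J x (gen a j (r , a≈rb) j∈J x≈aj) = r * j , *-closed J r j∈J , (begin
    x           ≈⟨ x≈aj ⟩
    a * j       ≈⟨ *-congʳ (trans a≈rb (*-comm r b)) ⟩
    b * r * j   ≈⟨ *-assoc b r j ⟩
    b * (r * j) ∎)
  principal-product {b} J x (nil x≈0) = 0# , 0∈ J , trans x≈0 (sym (zeroʳ b))
  principal-product {b} J x (sum y z y∈bJ z∈bJ x≈y+z)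
    with principal-product J y y∈bJ | principal-product J z z∈bJ
  ... | j , j∈J , y≈bj | k , k∈J , z≈bk =
    j + k , +-closed J j∈J k∈J , trans x≈y+z (trans (+-cong y≈bj z≈bk) (sym (distribˡ b j k)))

  principal-meet : ∀ {b} J → Adjacent R ⟨ b ⟩ J → ∀ x → x ∈ ⟨ b ⟩ → x ∈ J →
                   Σ Carrier λ j → j ∈ J × x ≈ b * j
  principal-meet J (_ , meet⊆bJ) x x∈⟨b⟩ x∈J = principal-product J x (meet⊆bJ x (x∈⟨b⟩ , x∈J))

  regular⇒adjacent : VonNeumannRegular R → ∀ I J → Adjacent R I J
  regular⇒adjacent regular I J = meet⊆product⇒adjacent I J λ x x∈I x∈J →
    let (y , x≈xyx) = regular x
    in gen (x * y) x (∈-resp I (*-comm y x) (*-closed I y x∈I)) x∈J x≈xyx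

  Reduced : Set (c ⊔ ℓ)
  Reduced = ∀ x → x * x ≈ 0# → x ≈ 0#

  -- In a reduced ring, x²·y = 0 implies x·y = 0, since (x·y)² = (x²·y)·y.
  reduced-cancel : Reduced → ∀ x y → x * x * y ≈ 0# → x * y ≈ 0#
  reduced-cancel reduced x y x²y≈0 = reduced (x * y) (begin
    (x * y) * (x * y) ≈⟨ *-interchange x y x y ⟩
    (x * x) * (y * y) ≈⟨ *-assoc (x * x) y y ⟨
    x * x * y * y     ≈⟨ *-congʳ x²y≈0 ⟩
    0# * y            ≈⟨ zeroˡ y ⟩
    0#                ∎)

  fixed⇒annihilated : ∀ x y → x ≈ x * y → x * (1# - y) ≈ 0#
  fixed⇒annihilated x y x≈xy =
    trans (x[y-z]≈xy-xz x 1# y) (x≈y⇒x∙y⁻¹≈ε (trans (*-identityʳ x) x≈xy))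

  annihilated⇒fixed : ∀ x y → x * (1# - y) ≈ 0# → x ≈ x * y
  annihilated⇒fixed x y x[1-y]≈0 = trans (sym (*-identityʳ x))
    (x∙y⁻¹≈ε⇒x≈y (x * 1#) (x * y) (trans (sym (x[y-z]≈xy-xz x 1# y)) x[1-y]≈0))

  module Classical (lem : ExcludedMiddle (c ⊔ ℓ)) where

    nontrivial-or-adjacent : ∀ I → NonTrivial R I ⊎ (∀ J → Adjacent R I J)
    nontrivial-or-adjacent I with lem {_≐_ R I (zeroIdeal R)} | lem {_≐_ R I (unitIdeal R)}
    ... | yes I≐0 | _       = inj₂ λ J → zero-adjacent I J I≐0
    ... | no _    | yes I≐R = inj₂ λ J → unit-adjacent I J I≐R
    ... | no I≢0  | no I≢R  = inj₁ (I≢0 , I≢R)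

    Γ₀Complete⇒Γ₁DistinctAdjacent : Γ₀Complete R → Γ₁DistinctAdjacent R
    Γ₀Complete⇒Γ₁DistinctAdjacent complete I J I≢J
      with nontrivial-or-adjacent I | nontrivial-or-adjacent J
    ... | inj₂ I-adj | _          = I-adj J
    ... | inj₁ _     | inj₂ J-adj = adjacent-sym J I (J-adj I)
    ... | inj₁ I-ntr | inj₁ J-ntr = complete I J I-ntr J-ntr I≢J

    equal-or-adjacent : Γ₁DistinctAdjacent R → ∀ I J → _≐_ R I J ⊎ Adjacent R I J
    equal-or-adjacent distinct-adjacent I J with lem {_≐_ R I J}
    ... | yes I≐J = inj₁ I≐J
    ... | no I≢J  = inj₂ (distinct-adjacent I J I≢J)

    another-vertex : Γ₀HasTwoVertices R → ∀ I → Σ (Ideal R) λ K → NonTrivial R K × ¬ _≐_ R I K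
    another-vertex (P , Q , P-ntr , Q-ntr , P≢Q) I with lem {_≐_ R P I}
    ... | yes (P⊆I , I⊆P) = Q , Q-ntr , λ { (I⊆Q , Q⊆I) →
                              P≢Q ((λ x x∈P → I⊆Q x (P⊆I x x∈P)) , (λ x x∈Q → I⊆P x (Q⊆I x x∈Q))) }
    ... | no P≢I          = P , P-ntr , λ { (I⊆P , P⊆I) → P≢I (P⊆I , I⊆P) }

    module Converse (two : Γ₀HasTwoVertices R) (distinct-adjacent : Γ₁DistinctAdjacent R) where

      module NonzeroSquareZero (b : Carrier) (b²≈0 : b * b ≈ 0#) (b≉0 : ¬ b ≈ 0#) where

        ⟨b⟩⊆Ann : ∀ x → x ∈ ⟨ b ⟩ → b * x ≈ 0#
        ⟨b⟩⊆Ann x (r , x≈rb) = begin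
          b * x       ≈⟨ *-congˡ (trans x≈rb (*-comm r b)) ⟩
          b * (b * r) ≈⟨ *-assoc b b r ⟨
          b * b * r   ≈⟨ *-congʳ b²≈0 ⟩
          0# * r      ≈⟨ zeroˡ r ⟩
          0#          ∎

        -- Ann(b) ⊆ ⟨ b ⟩: otherwise the two are adjacent, and b ∈ ⟨ b ⟩ ∩ Ann(b) = b·Ann(b) = 0.
        Ann⊆⟨b⟩ : ∀ x → b * x ≈ 0# → x ∈ ⟨ b ⟩
        Ann⊆⟨b⟩ x bx≈0 with equal-or-adjacent distinct-adjacent ⟨ b ⟩ (Ann b)
        ... | inj₁ (_ , Ann⊆) = Ann⊆ x (lift bx≈0)
        ... | inj₂ adj with principal-meet (Ann b) adj b (b∈⟨b⟩ b) (lift b²≈0)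
        ...   | j , lift bj≈0 , b≈bj = ⊥-elim (b≉0 (trans b≈bj bj≈0))

        -- An ideal K adjacent to ⟨ b ⟩ and containing b contains 1: b = b·k with k ∈ K,
        -- so 1 − k ∈ Ann(b) ⊆ ⟨ b ⟩ ⊆ K.
        adjacent-through-b⇒1∈ : ∀ K → Adjacent R ⟨ b ⟩ K → b ∈ K → 1# ∈ K
        adjacent-through-b⇒1∈ K adj b∈K with principal-meet K adj b (b∈⟨b⟩ b) b∈K
        ... | k , k∈K , b≈bk = ∈-resp K (//-rightDividesˡ k 1#) (+-closed K 1-k∈K k∈K)
          where
            1-k∈K : (1# - k) ∈ K
            1-k∈K = ⟨⟩-least K b∈K (1# - k) (Ann⊆⟨b⟩ (1# - k) (fixed⇒annihilated b k b≈bk))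

        -- If 1 = i + k with i ∈ ⟨ b ⟩, then b = b·k.
        1∈⟨b⟩⊕K⇒b∈K : ∀ K → 1# ∈ (⟨ b ⟩ ⊕ K) → b ∈ K
        1∈⟨b⟩⊕K⇒b∈K K (i , k , i∈⟨b⟩ , k∈K , 1≈i+k) = ∈-resp K (sym b≈bk) (*-closed K b k∈K)
          where
            b≈bk : b ≈ b * k
            b≈bk = begin
              b             ≈⟨ *-identityʳ b ⟨
              b * 1#        ≈⟨ *-congˡ 1≈i+k ⟩
              b * (i + k)   ≈⟨ distribˡ b i k ⟩
              b * i + b * k ≈⟨ +-congʳ (⟨b⟩⊆Ann i i∈⟨b⟩) ⟩
              0# + b * k    ≈⟨ +-identityˡ (b * k) ⟩
              b * k         ∎

        -- A vertex K ≠ ⟨ b ⟩ is adjacent to ⟨ b ⟩, so it is neither inside ⟨ b ⟩ (then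
        -- K = K ∩ ⟨ b ⟩ = b·K = 0) nor does it contain b (then 1 ∈ K).
        module _ (K : Ideal R) (⟨b⟩≢K : ¬ _≐_ R ⟨ b ⟩ K) where

          ⊆⟨b⟩⇒zero : (∀ x → x ∈ K → x ∈ ⟨ b ⟩) → _≐_ R K (zeroIdeal R)
          ⊆⟨b⟩⇒zero K⊆⟨b⟩ = (λ x x∈K → lift (K-zero x x∈K)) ,
                             (λ x x≈0 → ∈-resp K (sym (lower x≈0)) (0∈ K))
            where
              K-zero : ∀ x → x ∈ K → x ≈ 0#
              K-zero x x∈K with principal-meet K (distinct-adjacent ⟨ b ⟩ K ⟨b⟩≢K) x (K⊆⟨b⟩ x x∈K) x∈K
              ... | j , j∈K , x≈bj = trans x≈bj (⟨b⟩⊆Ann j (K⊆⟨b⟩ j j∈K))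

          ∋b⇒unit : b ∈ K → _≐_ R K (unitIdeal R)
          ∋b⇒unit b∈K = 1∈⇒unit K (adjacent-through-b⇒1∈ K (distinct-adjacent ⟨ b ⟩ K ⟨b⟩≢K) b∈K)

        -- The ideal ⟨ b ⟩ ⊕ K for a second vertex K either equals ⟨ b ⟩, so K ⊆ ⟨ b ⟩, or is
        -- adjacent to ⟨ b ⟩ and hence contains 1, so b ∈ K.
        contradiction : ⊥
        contradiction with another-vertex two ⟨ b ⟩
        ... | K , (K≢0 , K≢R) , ⟨b⟩≢K with equal-or-adjacent distinct-adjacent ⟨ b ⟩ (⟨ b ⟩ ⊕ K)
        ...   | inj₁ (_ , ⟨b⟩⊕K⊆⟨b⟩) = K≢0 (⊆⟨b⟩⇒zero K ⟨b⟩≢K λ x x∈K →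
                  ⟨b⟩⊕K⊆⟨b⟩ x (0# , x , 0∈ ⟨ b ⟩ , x∈K , sym (+-identityˡ x)))
        ...   | inj₂ adj = K≢R (∋b⇒unit K ⟨b⟩≢K (1∈⟨b⟩⊕K⇒b∈K K
                  (adjacent-through-b⇒1∈ (⟨ b ⟩ ⊕ K) adj (b , 0# , b∈⟨b⟩ b , 0∈ K , sym (+-identityʳ b)))))

      reduced : Reduced
      reduced b b²≈0 with lem {Lift c (b ≈ 0#)}
      ... | yes (lift b≈0) = b≈0
      ... | no b≉0         = ⊥-elim (NonzeroSquareZero.contradiction b b²≈0 λ b≈0 → b≉0 (lift b≈0))

      -- Compare ⟨ a² ⟩ with ⟨ a ⟩: equality gives a = r·a², adjacency gives a² = a²·(s·a).
      regular : VonNeumannRegular R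
      regular a with equal-or-adjacent distinct-adjacent ⟨ a * a ⟩ ⟨ a ⟩
      ... | inj₁ (_ , ⟨a⟩⊆⟨a²⟩) with ⟨a⟩⊆⟨a²⟩ a (b∈⟨b⟩ a)
      ...   | r , a≈ra² = r , (begin
                a           ≈⟨ a≈ra² ⟩
                r * (a * a) ≈⟨ *-assoc r a a ⟨
                r * a * a   ≈⟨ *-congʳ (*-comm r a) ⟩
                a * r * a   ∎)
      regular a | inj₂ adj with principal-meet ⟨ a ⟩ adj (a * a) (b∈⟨b⟩ (a * a)) (a , refl)
      ...   | j , (s , j≈sa) , a²≈a²j = s , (begin
                a           ≈⟨ annihilated⇒fixed a (s * a) a[1-sa]≈0 ⟩
                a * (s * a) ≈⟨ *-assoc a s a ⟨
                a * s * a   ∎)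
        where
          a[1-sa]≈0 : a * (1# - s * a) ≈ 0#
          a[1-sa]≈0 = reduced-cancel reduced a (1# - s * a)
            (fixed⇒annihilated (a * a) (s * a) (trans a²≈a²j (*-congˡ j≈sa)))

mainTheorem3 : ∀ {c ℓ : Level} → ExcludedMiddle (c ⊔ ℓ) → (R : CommutativeRing c ℓ) →
    Γ₀HasTwoVertices R →
    (VonNeumannRegular R ⇔ Γ₀Complete R) × (VonNeumannRegular R ⇔ Γ₁DistinctAdjacent R)
mainTheorem3 lem R two =
  mk⇔ (λ regular I J _ _ _ → regular⇒adjacent regular I J)
      (λ complete → Converse.regular two (Γ₀Complete⇒Γ₁DistinctAdjacent complete)) ,
  mk⇔ (λ regular I J _ → regular⇒adjacent regular I J)
      (Converse.regular two)
  where
    open IdealTheory R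
    open Classical lem
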